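{- Let $m \geq \ell \geq 2$ and $n \geq 0$, let $B \subseteq m^n$ be a set of leaves, and let $\ddot B$ be its $\ell$-ary normalization, defined as in the context with respect to any enumeration $(a_i : i < N)$ of $m^{<n}$ in which longer sequences come first. Then \[ \mathrm{MTD}_\ell(B) = \|\ddot B\|_\ell. \]
   Context: Nodes are sequences of length at most $n$ with entries in $\{0,\dots,m-1\}$ (the set $m^{\leq n}$), and $m^{<n}$ denotes those of length less than $n$. Leaves are elements of $m^n$. Write $a \prec b$ if $a$ is a proper initial segment of $b$, and let $a \wedge b$ be the longest common initial segment of $a$ and $b$. For $B \subseteq m^n$, $\check B$ is the set of all initial segments, including the sequences themselves, of elements of $B$. The meeted $\ell$-ary tree of height $d$ is $\hat T_{d,\ell} = (\ell^{\leq d}, \prec, \wedge)$. An embedding $f$ of $(A,\prec,\wedge)$ into $(A',\prec,\wedge)$ is an injective map such that for all $a,a'$: $a \prec a'$ iff $f(a) \prec f(a')$, and $f(a\wedge a') = f(a) \wedge f(a')$. For nonempty $B \subseteq m^n$, the meeted $\ell$-ary tree dimension $\mathrm{MTD}_\ell(B)$ is the largest nonnegative integer $d$ such that $\hat T_{d,\ell}$ embeds in $(\check B, \prec, \wedge)$. Set $\mathrm{MTD}_\ell(\emptyset) = -1$. $\ell$-ary norm: for a node $a$, $\|a\|_\ell$ is the number of indices $i < |a|$ with $a(i) \geq \ell - 1$. For a nonempty set of nodes $A$, $\|A\|_\ell = \max_{a\in A}\|a\|_\ell$, and $\|\emptyset\|_\ell = -1$. For a node $a$ and a set of nodes $A$,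 $A{\restriction}_a$ is the set of elements of $A$ having $a$ as an initial segment. Swaps: for $a \in m^{<n}$ and $k < m-1$, $\sigma_{a,k}$ is the map on $m^{\leq n}$ with $a^\frown k^\frown b \mapsto a^\frown (k+1)^\frown b$ and $a^\frown (k+1)^\frown b \mapsto a^\frown k^\frown b$ for every sequence $b$ of length at most $n-|a|-1$. It fixes all other nodes. $\ell$-ary normalization: let $N = m^{n-1} + \cdots + m^0$, and let $(a_i : i < N)$ enumerate $m^{<n}$ so that $|a_i| > |a_j|$ implies $i<j$. Put $B_0 = B$. For each $i < N$ in turn: - Set $B_{i,0} = B_i$. - For each $j < m-1$ in turn, set $B_{i,j,0} = B_{i,j}$, and then for each $k < m-j-1$ in turn: - if $\|B_{i,j,k}{\restriction}_{a_i^\frown k}\|_\ell - \|a_i^\frown k\|_\ell \geq \|B_{i,j,k}{\restriction}_{a_i^\frown (k+1)}\|_\ell - \|a_i^\frown (k+1)\|_\ell$, let $B_{i,j,k+1} = B_{i,j,k}$; - otherwise let $B_{i,j,k+1} = \sigma_{a_i,k}(B_{i,j,k})$. - After the $k$-loop, let $B_{i,j+1} = B_{i,j,m-j-1}$. - After the $j$-loop, let $B_{i+1} = B_{i,m-1}$. Finally $\ddot B = B_N$. -}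

module Defs where

open import Data.Nat using (ℕ; zero; suc; _+_; _∸_; _≤_; _<_; _≥_; _≤?_; _≡ᵇ_)
open import Data.Nat.Properties using () renaming (_≟_ to _≟ℕ_)
open import Data.Bool using (Bool; true; false; if_then_else_; T)
open import Data.Integer as ℤ using (ℤ; +_; -[1+_]; _-_; _⊔_)
open import Data.Fin using (Fin)
open import Data.List using (List; []; _∷_; _++_; length; filter; map; concatMap; upTo; foldl; foldr)
open import Data.List.Membership.Propositional using (_∈_)
open import Data.List.Relation.Unary.Any using (Any)
open import Data.Product using (Σ; _×_; ∃; ∃-syntax; _,_)
open import Data.Sum using (_⊎_)
open import Relation.Binary.PropositionalEquality using (_≡_; _≢_)
open import Relation.Binary.Definitions using (DecidableEquality)
open import Relation.Nullary using (Dec; yes; no; ¬_)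

IsPrefix : {A : Set} → List A → List A → Set
IsPrefix a b = ∃[ c ] (a ++ c ≡ b)

_≺_ : {A : Set} → List A → List A → Set
a ≺ b = IsPrefix a b × length a < length b

meet : {A : Set} → DecidableEquality A → List A → List A → List A
meet _≟_ [] _ = []
meet _≟_ (_ ∷ _) [] = []
meet _≟_ (x ∷ xs) (y ∷ ys) with x ≟ y
... | yes _ = x ∷ meet _≟_ xs ys
... | no _ = []

prefixᵇ : List ℕ → List ℕ → Bool
prefixᵇ [] _ = true
prefixᵇ (_ ∷ _) [] = false
prefixᵇ (x ∷ xs) (y ∷ ys) = if x ≡ᵇ y then prefixᵇ xs ys else false

seqs : ℕ → ℕ → List (List ℕ)
seqs m zero = [] ∷ []
seqs m (suc k) = concatMap (λ x → map (x ∷_) (seqs m k)) (upTo m)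

nodesLt : ℕ → ℕ → List (List ℕ)
nodesLt m n = concatMap (seqs m) (upTo n)

-- Sets of leaves B ⊆ m^n are given as lists (repetitions irrelevant).

IsLeafSet : ℕ → ℕ → List (List ℕ) → Set
IsLeafSet m n B = ∀ b → b ∈ B → (length b ≡ n) × (∀ x → x ∈ b → x < m)

restrict : List (List ℕ) → List ℕ → List (List ℕ)
restrict B a = filter (λ b → T? (prefixᵇ a b)) B
  where
  T? : (b : Bool) → Dec (T b)
  T? true = yes _
  T? false = no (λ ())

nodeNorm : ℕ → List ℕ → ℕ
nodeNorm ℓ a = length (filter (λ x → (ℓ ∸ 1) ≤? x) a)

setNorm : ℕ → List (List ℕ) → ℤ
setNorm ℓ A = foldr (λ a r → (+ nodeNorm ℓ a) ⊔ r) -[1+ 0 ] A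

swapEntry : ℕ → ℕ → ℕ
swapEntry k y = if y ≡ᵇ k then suc k else (if y ≡ᵇ suc k then k else y)

swap : List ℕ → ℕ → List ℕ → List ℕ
swap [] k [] = []
swap [] k (y ∷ ys) = swapEntry k y ∷ ys
swap (a ∷ as) k [] = []
swap (a ∷ as) k (y ∷ ys) = if a ≡ᵇ y then y ∷ swap as k ys else y ∷ ys

score : ℕ → List (List ℕ) → List ℕ → ℤ
score ℓ B x = setNorm ℓ (restrict B x) - (+ nodeNorm ℓ x)

-- one k-step at node a:  B_{i,j,k} ↦ B_{i,j,k+1}
kStep : ℕ → List ℕ → List (List ℕ) → ℕ → List (List ℕ)
kStep ℓ a B k with score ℓ B (a ++ (suc k ∷ [])) ℤ.≤? score ℓ B (a ++ (k ∷ []))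
... | yes _ = B
... | no _ = map (swap a k) B

-- the k-loop (k < m - j - 1) : B_{i,j} ↦ B_{i,j+1}
jStep : ℕ → ℕ → List ℕ → List (List ℕ) → ℕ → List (List ℕ)
jStep m ℓ a B j = foldl (kStep ℓ a) B (upTo (m ∸ j ∸ 1))

-- the j-loop (j < m - 1) : B_i ↦ B_{i+1}
iStep : ℕ → ℕ → List (List ℕ) → List ℕ → List (List ℕ)
iStep m ℓ B a = foldl (jStep m ℓ a) B (upTo (m ∸ 1))

normalize : ℕ → ℕ → List (List ℕ) → List (List ℕ) → List (List ℕ)
normalize m ℓ enum B = foldl (iStep m ℓ) B enum

InTree : {ℓ : ℕ} → ℕ → List (Fin ℓ) → Set
InTree d a = length a ≤ d

InCheck : List (List ℕ) → List ℕ → Set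
InCheck B x = ∃[ b ] (b ∈ B × IsPrefix x b)

record IsEmbedding (ℓ d : ℕ) (B : List (List ℕ)) (f : List (Fin ℓ) → List ℕ) : Set where
  field
    into      : ∀ a → InTree d a → InCheck B (f a)
    injective : ∀ a a' → InTree d a → InTree d a' → f a ≡ f a' → a ≡ a'
    pres-≺    : ∀ a a' → InTree d a → InTree d a' → (a ≺ a' → f a ≺ f a') × (f a ≺ f a' → a ≺ a')
    pres-∧    : ∀ a a' → InTree d a → InTree d a' →
                f (meet Data.Fin._≟_ a a') ≡ meet _≟ℕ_ (f a) (f a')

TreeEmbeds : ℕ → ℕ → List (List ℕ) → Set
TreeEmbeds ℓ d B = ∃[ f ] IsEmbedding ℓ d B f

IsMTD : ℕ → List (List ℕ) → ℤ → Set
IsMTD ℓ B t =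
  (B ≡ [] × t ≡ -[1+ 0 ])
  ⊎ (B ≢ [] × ∃[ d ] (t ≡ + d × TreeEmbeds ℓ d B × (∀ d' → TreeEmbeds ℓ d' B → d' ≤ d)))

-- Write score B x = ‖B↾x‖ − ‖x‖; for x ∈ Č B it counts the entries ≥ ℓ − 1 that the best leaf
-- below x has after x. Swapping two sibling subtrees preserves ≺ and ∧, so it does not change which
-- trees embed, and normalization is a bubble sort by such swaps: afterwards, at every node, the
-- nonnegative scores of the children are nonincreasing. For such a sorted set, an embedded node
-- has ℓ children in pairwise distinct directions, one of them ≥ ℓ − 1; by sortedness direction
-- ℓ − 1 scores at least as well, and passing through it adds one to the norm, so a tree of
-- height d forces score d at the root and d ≤ ‖B̈‖. Conversely, following the heaviest leaf below
-- a node to its first entry x ≥ ℓ − 1 and branching into the children 0, …, ℓ − 1 ≤ x, which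
-- score at least as well as x, embeds the tree of height ‖B̈‖.

{-# OPTIONS --safe #-}
module Submission where

open import Defs
import Data.Nat as ℕ
open import Data.Nat using (ℕ; zero; suc; _+_; _∸_; _≡ᵇ_; _≤_; _<_; _≥_; _≤?_; _<?_; z≤n; s≤s)
import Data.Nat.Properties as ℕP
open import Data.Nat.Properties using () renaming (_≟_ to _≟ℕ_)
open import Data.Bool using (true; false; T; if_then_else_)
open import Data.Unit using (tt)
open import Data.Empty using (⊥-elim)
open import Data.Fin using (Fin; toℕ; fromℕ<) renaming (_≟_ to _≟F_)
import Data.Fin.Properties as FinP
open import Data.Integer as ℤ using (ℤ; +_; -[1+_]; _-_; _⊔_)
import Data.Integer.Properties as ℤP
open import Data.Integer.Tactic.RingSolver using (solve-∀)
import Data.Nat.Tactic.RingSolver as ℕSolver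
open import Data.List using (List; []; _∷_; [_]; _++_; length; map; filter; foldl; upTo; drop)
open import Data.List.Properties using (++-assoc; ++-identityʳ; length-++; foldl-∷ʳ; upTo-∷ʳ; ∷-injectiveˡ; ∷-injectiveʳ; ≡-dec; filter-++; filter-accept; filter-reject)
open import Data.List.Membership.Propositional using (_∈_; lose)
open import Data.List.Membership.Propositional.Properties using (∈-++⁺ˡ; ∈-++⁺ʳ; ∈-map⁺; ∈-map⁻; ∈-filter⁺; ∈-filter⁻; ∈-concatMap⁺; ∈-upTo⁺)
open import Data.List.Relation.Unary.Any using (here; there)
open import Data.List.Relation.Unary.All as All using ()
open import Data.List.Relation.Unary.AllPairs using (AllPairs; []; _∷_)
open import Data.List.Relation.Binary.Permutation.Propositional using (_↭_; ↭-sym)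
open import Data.List.Relation.Binary.Permutation.Propositional.Properties using (∈-resp-↭)
open import Data.Product using (∃₂; ∃-syntax; _×_; _,_; proj₁; proj₂)
open import Data.Sum using (_⊎_; inj₁; inj₂)
open import Function using (_∘_; _⇔_; mk⇔; Equivalence)
open import Function.Construct.Composition using (_⇔-∘_)
open import Function.Construct.Identity using (⇔-id)
open import Relation.Binary.Definitions using (DecidableEquality)
open import Relation.Binary.PropositionalEquality hiding ([_])
open import Relation.Nullary using (Dec; yes; no; ¬_)
open import Relation.Nullary.Decidable using (dec-true; dec-false)

≡ᵇ-refl : ∀ n → (n ≡ᵇ n) ≡ true
≡ᵇ-refl n = dec-true (n ≟ℕ n) refl

≢⇒≡ᵇ-false : ∀ {m n} → m ≢ n → (m ≡ᵇ n) ≡ false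
≢⇒≡ᵇ-false {m} {n} = dec-false (m ≟ℕ n)

swapEntry-k : ∀ k → swapEntry k k ≡ suc k
swapEntry-k k rewrite ≡ᵇ-refl k = refl

swapEntry-suc : ∀ k → swapEntry k (suc k) ≡ k
swapEntry-suc k rewrite ≢⇒≡ᵇ-false (ℕP.1+n≢n {k}) | ≡ᵇ-refl k = refl

swapEntry-other : ∀ k y → y ≢ k → y ≢ suc k → swapEntry k y ≡ y
swapEntry-other k y y≢k y≢1+k rewrite ≢⇒≡ᵇ-false y≢k | ≢⇒≡ᵇ-false y≢1+k = refl

swapEntry-involutive : ∀ k y → swapEntry k (swapEntry k y) ≡ y
swapEntry-involutive k y with y ≟ℕ k | y ≟ℕ suc k
... | yes refl | _ rewrite swapEntry-k y = swapEntry-suc y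
... | no _ | yes refl rewrite swapEntry-suc k = swapEntry-k k
... | no y≢k | no y≢1+k rewrite swapEntry-other k y y≢k y≢1+k = swapEntry-other k y y≢k y≢1+k

swapEntry-injective : ∀ k {y z} → swapEntry k y ≡ swapEntry k z → y ≡ z
swapEntry-injective k {y} {z} eq =
  trans (sym (swapEntry-involutive k y)) (trans (cong (swapEntry k) eq) (swapEntry-involutive k z))

swapEntry-≡ᵇ : ∀ k y z → (swapEntry k y ≡ᵇ swapEntry k z) ≡ (y ≡ᵇ z)
swapEntry-≡ᵇ k y z with y ≟ℕ z
... | yes refl = trans (≡ᵇ-refl (swapEntry k y)) (sym (≡ᵇ-refl y))
... | no y≢z = trans (≢⇒≡ᵇ-false (y≢z ∘ swapEntry-injective k)) (sym (≢⇒≡ᵇ-false y≢z))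

swapEntry-< : ∀ {m} k y → y < m → suc k < m → swapEntry k y < m
swapEntry-< k y y<m 1+k<m with y ≟ℕ k | y ≟ℕ suc k
... | yes refl | _ rewrite swapEntry-k y = 1+k<m
... | no _ | yes refl rewrite swapEntry-suc k = ℕP.<-trans (ℕP.n<1+n k) 1+k<m
... | no y≢k | no y≢1+k rewrite swapEntry-other k y y≢k y≢1+k = y<m

swap-∷-≡ : ∀ a as k ys → swap (a ∷ as) k (a ∷ ys) ≡ a ∷ swap as k ys
swap-∷-≡ a as k ys rewrite ≡ᵇ-refl a = refl

swap-∷-≢ : ∀ {a y} as k ys → a ≢ y → swap (a ∷ as) k (y ∷ ys) ≡ y ∷ ys
swap-∷-≢ as k ys a≢y rewrite ≢⇒≡ᵇ-false a≢y = refl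

swap-∷-head : ∀ a as k y ys → ∃[ zs ] swap (a ∷ as) k (y ∷ ys) ≡ y ∷ zs
swap-∷-head a as k y ys with a ≟ℕ y
... | yes refl = _ , swap-∷-≡ a as k ys
... | no a≢y = _ , swap-∷-≢ as k ys a≢y

swap-involutive : ∀ a k x → swap a k (swap a k x) ≡ x
swap-involutive [] k [] = refl
swap-involutive [] k (y ∷ ys) = cong (_∷ ys) (swapEntry-involutive k y)
swap-involutive (a ∷ as) k [] = refl
swap-involutive (a ∷ as) k (y ∷ ys) with a ≟ℕ y
... | yes refl rewrite swap-∷-≡ a as k ys | swap-∷-≡ a as k (swap as k ys) =
  cong (a ∷_) (swap-involutive as k ys)
... | no a≢y rewrite swap-∷-≢ as k ys a≢y = swap-∷-≢ as k ys a≢y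

swap-injective : ∀ a k {x y} → swap a k x ≡ swap a k y → x ≡ y
swap-injective a k {x} {y} eq =
  trans (sym (swap-involutive a k x)) (trans (cong (swap a k) eq) (swap-involutive a k y))

map-swap-involutive : ∀ a k B → map (swap a k) (map (swap a k) B) ≡ B
map-swap-involutive a k [] = refl
map-swap-involutive a k (b ∷ B) = cong₂ _∷_ (swap-involutive a k b) (map-swap-involutive a k B)

length-swap : ∀ a k x → length (swap a k x) ≡ length x
length-swap [] k [] = refl
length-swap [] k (y ∷ ys) = refl
length-swap (a ∷ as) k [] = refl
length-swap (a ∷ as) k (y ∷ ys) with a ≟ℕ y
... | yes refl rewrite swap-∷-≡ a as k ys = cong suc (length-swap as k ys)
... | no a≢y rewrite swap-∷-≢ as k ys a≢y = refl

swap-short : ∀ a k x → length x ≤ length a → swap a k x ≡ x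
swap-short [] k [] _ = refl
swap-short (a ∷ as) k [] _ = refl
swap-short (a ∷ as) k (y ∷ ys) (s≤s le) with a ≟ℕ y
... | yes refl rewrite swap-∷-≡ a as k ys = cong (a ∷_) (swap-short as k ys le)
... | no a≢y = swap-∷-≢ as k ys a≢y

swap-child : ∀ a k y w → swap a k (a ++ y ∷ w) ≡ a ++ swapEntry k y ∷ w
swap-child [] k y w = refl
swap-child (a ∷ as) k y w rewrite swap-∷-≡ a as k (as ++ y ∷ w) = cong (a ∷_) (swap-child as k y w)

swap-++ : ∀ a k u w → length a ≤ length u → u ≢ a → swap a k (u ++ w) ≡ swap a k u ++ w
swap-++ [] k [] w _ u≢a = ⊥-elim (u≢a refl)
swap-++ [] k (y ∷ us) w _ _ = refl
swap-++ (a ∷ as) k (y ∷ us) w (s≤s le) u≢a with a ≟ℕ y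
... | yes refl rewrite swap-∷-≡ a as k (us ++ w) | swap-∷-≡ a as k us =
  cong (a ∷_) (swap-++ as k us w le (u≢a ∘ cong (a ∷_)))
... | no a≢y rewrite swap-∷-≢ as k (us ++ w) a≢y | swap-∷-≢ as k us a≢y = refl

Entries< : ℕ → List ℕ → Set
Entries< m x = ∀ z → z ∈ x → z < m

swap-entries< : ∀ {m} a k x → suc k < m → Entries< m x → Entries< m (swap a k x)
swap-entries< [] k (y ∷ ys) 1+k<m x<m z (here refl) = swapEntry-< k y (x<m y (here refl)) 1+k<m
swap-entries< [] k (y ∷ ys) 1+k<m x<m z (there z∈) = x<m z (there z∈)
swap-entries< (a ∷ as) k (y ∷ ys) 1+k<m x<m z z∈ with a ≟ℕ y
swap-entries< (a ∷ as) k (y ∷ ys) 1+k<m x<m z z∈ | yes refl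
  rewrite swap-∷-≡ a as k ys with z∈
... | here refl = x<m z (here refl)
... | there z∈′ = swap-entries< as k ys 1+k<m (λ w → x<m w ∘ there) z z∈′
swap-entries< (a ∷ as) k (y ∷ ys) 1+k<m x<m z z∈ | no a≢y
  rewrite swap-∷-≢ as k ys a≢y = x<m z z∈

prefixᵇ-swap : ∀ a k u v → prefixᵇ (swap a k u) (swap a k v) ≡ prefixᵇ u v
prefixᵇ-swap [] k [] v = refl
prefixᵇ-swap [] k (y ∷ us) [] = refl
prefixᵇ-swap [] k (y ∷ us) (z ∷ vs) rewrite swapEntry-≡ᵇ k y z = refl
prefixᵇ-swap (a ∷ as) k [] v = refl
prefixᵇ-swap (a ∷ as) k (y ∷ us) [] with swap-∷-head a as k y us
... | _ , eq rewrite eq = refl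
prefixᵇ-swap (a ∷ as) k (y ∷ us) (z ∷ vs) with y ≟ℕ z
prefixᵇ-swap (a ∷ as) k (y ∷ us) (.y ∷ vs) | yes refl with a ≟ℕ y
... | yes refl rewrite swap-∷-≡ a as k us | swap-∷-≡ a as k vs | ≡ᵇ-refl a = prefixᵇ-swap as k us vs
... | no a≢y rewrite swap-∷-≢ as k us a≢y | swap-∷-≢ as k vs a≢y = refl
prefixᵇ-swap (a ∷ as) k (y ∷ us) (z ∷ vs) | no y≢z
  with swap-∷-head a as k y us | swap-∷-head a as k z vs
... | _ , eq₁ | _ , eq₂ rewrite eq₁ | eq₂ | ≢⇒≡ᵇ-false y≢z = refl

module _ {A : Set} where

  prefix-refl : (u : List A) → IsPrefix u u
  prefix-refl u = [] , ++-identityʳ u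

  prefix-++ : (u w : List A) → IsPrefix u (u ++ w)
  prefix-++ u w = w , refl

  prefix-trans : {u v w : List A} → IsPrefix u v → IsPrefix v w → IsPrefix u w
  prefix-trans {u} (c , refl) (c′ , refl) = c ++ c′ , sym (++-assoc u c c′)

  prefix-∷ : ∀ x {u v : List A} → IsPrefix u v → IsPrefix (x ∷ u) (x ∷ v)
  prefix-∷ x (c , eq) = c , cong (x ∷_) eq

  prefix-∷⁻ : ∀ {x y} {u v : List A} → IsPrefix (x ∷ u) (y ∷ v) → x ≡ y × IsPrefix u v
  prefix-∷⁻ (c , eq) = ∷-injectiveˡ eq , (c , ∷-injectiveʳ eq)

  prefix-length : {u v : List A} → IsPrefix u v → length u ≤ length v
  prefix-length {u} (c , refl) rewrite length-++ u {c} = ℕP.m≤m+n _ _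

  prefix-length-≥⇒≡ : {u v : List A} → IsPrefix u v → length v ≤ length u → u ≡ v
  prefix-length-≥⇒≡ {u} ([] , refl) _ = sym (++-identityʳ u)
  prefix-length-≥⇒≡ {u} (x ∷ c , refl) le rewrite length-++ u {x ∷ c} =
    ⊥-elim (ℕP.<-irrefl refl (ℕP.<-≤-trans (ℕP.m<m+n (length u) (s≤s z≤n)) le))

  prefix-≢⇒length< : {u v : List A} → IsPrefix u v → u ≢ v → length u < length v
  prefix-≢⇒length< {u} {v} p u≢v = ℕP.≰⇒> (u≢v ∘ prefix-length-≥⇒≡ p)

  prefix-∈ : {u v : List A} {z : A} → IsPrefix u v → z ∈ u → z ∈ v
  prefix-∈ (c , refl) z∈ = ∈-++⁺ˡ z∈

  prefix-++-cong : (c : List A) {u v : List A} → IsPrefix u v → IsPrefix (c ++ u) (c ++ v)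
  prefix-++-cong c {u} (w , eq) = w , trans (++-assoc c u w) (cong (c ++_) eq)

  length-snoc : (u : List A) (x : A) → length (u ++ [ x ]) ≡ suc (length u)
  length-snoc u x = trans (length-++ u) (ℕP.+-comm (length u) 1)

  length-<-snoc : (u : List A) (x : A) → length u < length (u ++ [ x ])
  length-<-snoc u x = ℕP.≤-reflexive (sym (length-snoc u x))

  ≺-snoc : (u : List A) (x : A) → u ≺ (u ++ [ x ])
  ≺-snoc u x = prefix-++ u [ x ] , length-<-snoc u x

  ≺⇒prefix-snoc : (u v : List A) → u ≺ v → ∃[ x ] IsPrefix (u ++ [ x ]) v
  ≺⇒prefix-snoc u v ((x ∷ c , eq) , _) = x , (c , trans (++-assoc u [ x ] c) eq)
  ≺⇒prefix-snoc u v (([] , eq) , lt) =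
    ⊥-elim (ℕP.<-irrefl (cong length (trans (sym (++-identityʳ u)) eq)) lt)

  drop-length-++ : (c v : List A) → drop (length c) (c ++ v) ≡ v
  drop-length-++ [] v = refl
  drop-length-++ (x ∷ c) v = drop-length-++ c v

module _ {A : Set} (_≟_ : DecidableEquality A) where

  private
    _⊓_ : List A → List A → List A
    _⊓_ = meet _≟_

  meet-∷-≡ : ∀ {x y} xs ys → x ≡ y → (x ∷ xs) ⊓ (y ∷ ys) ≡ x ∷ (xs ⊓ ys)
  meet-∷-≡ {x} {y} xs ys x≡y with x ≟ y
  ... | yes _ = refl
  ... | no x≢y = ⊥-elim (x≢y x≡y)

  meet-∷-≢ : ∀ {x y} xs ys → x ≢ y → (x ∷ xs) ⊓ (y ∷ ys) ≡ []
  meet-∷-≢ {x} {y} xs ys x≢y with x ≟ y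
  ... | yes x≡y = ⊥-elim (x≢y x≡y)
  ... | no _ = refl

  meet-[]ʳ : ∀ u → u ⊓ [] ≡ []
  meet-[]ʳ [] = refl
  meet-[]ʳ (x ∷ u) = refl

  meet-idem : ∀ u → u ⊓ u ≡ u
  meet-idem [] = refl
  meet-idem (x ∷ u) rewrite meet-∷-≡ u u (refl {x = x}) = cong (x ∷_) (meet-idem u)

  meet-comm : ∀ u v → u ⊓ v ≡ v ⊓ u
  meet-comm [] [] = refl
  meet-comm [] (y ∷ v) = refl
  meet-comm (x ∷ u) [] = refl
  meet-comm (x ∷ u) (y ∷ v) with x ≟ y
  ... | yes refl rewrite meet-∷-≡ v u (refl {x = x}) = cong (x ∷_) (meet-comm u v)
  ... | no x≢y = sym (meet-∷-≢ v u (x≢y ∘ sym))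

  meet-prefixˡ : ∀ u v → IsPrefix (u ⊓ v) u
  meet-prefixˡ [] v = _ , refl
  meet-prefixˡ (x ∷ u) [] = _ , refl
  meet-prefixˡ (x ∷ u) (y ∷ v) with x ≟ y
  ... | yes _ = prefix-∷ x (meet-prefixˡ u v)
  ... | no _ = _ , refl

  meet-prefixʳ : ∀ u v → IsPrefix (u ⊓ v) v
  meet-prefixʳ u v = subst (λ w → IsPrefix w v) (meet-comm v u) (meet-prefixˡ v u)

  prefix⇒meet≡ˡ : ∀ u v → IsPrefix u v → u ⊓ v ≡ u
  prefix⇒meet≡ˡ [] v _ = refl
  prefix⇒meet≡ˡ (x ∷ u) [] (_ , ())
  prefix⇒meet≡ˡ (x ∷ u) (y ∷ v) p with prefix-∷⁻ p
  ... | refl , p′ = trans (meet-∷-≡ u v refl) (cong (x ∷_) (prefix⇒meet≡ˡ u v p′))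

  prefix⇒meet≡ʳ : ∀ u v → IsPrefix v u → u ⊓ v ≡ v
  prefix⇒meet≡ʳ u v p = trans (meet-comm u v) (prefix⇒meet≡ˡ v u p)

  meet-greatest : ∀ w u v → IsPrefix w u → IsPrefix w v → IsPrefix w (u ⊓ v)
  meet-greatest [] u v _ _ = _ , refl
  meet-greatest (x ∷ w) [] v (_ , ()) _
  meet-greatest (x ∷ w) (y ∷ u) [] _ (_ , ())
  meet-greatest (x ∷ w) (y ∷ u) (z ∷ v) p q with prefix-∷⁻ p | prefix-∷⁻ q
  ... | refl , p′ | refl , q′ =
    subst (IsPrefix (x ∷ w)) (sym (meet-∷-≡ u v refl)) (prefix-∷ x (meet-greatest w u v p′ q′))

  meet-fork : ∀ u {x y} v w → x ≢ y → (u ++ x ∷ v) ⊓ (u ++ y ∷ w) ≡ u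
  meet-fork [] v w x≢y = meet-∷-≢ v w x≢y
  meet-fork (z ∷ u) {x} {y} v w x≢y =
    trans (meet-∷-≡ (u ++ x ∷ v) (u ++ y ∷ w) refl) (cong (z ∷_) (meet-fork u v w x≢y))

prefixᵇ-sound : ∀ u v → T (prefixᵇ u v) → IsPrefix u v
prefixᵇ-sound [] v _ = v , refl
prefixᵇ-sound (x ∷ u) (y ∷ v) t with x ≟ℕ y
... | yes refl rewrite ≡ᵇ-refl x = prefix-∷ x (prefixᵇ-sound u v t)
... | no x≢y rewrite ≢⇒≡ᵇ-false x≢y = ⊥-elim t

prefixᵇ-complete : ∀ u v → IsPrefix u v → T (prefixᵇ u v)
prefixᵇ-complete [] v _ = tt
prefixᵇ-complete (x ∷ u) [] (_ , ())
prefixᵇ-complete (x ∷ u) (y ∷ v) p with prefix-∷⁻ p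
... | refl , p′ rewrite ≡ᵇ-refl x = prefixᵇ-complete u v p′

-- Swaps are automorphisms of the tree

swap-prefix : ∀ a k {u v} → IsPrefix u v → IsPrefix (swap a k u) (swap a k v)
swap-prefix a k {u} {v} p =
  prefixᵇ-sound (swap a k u) (swap a k v) (subst T (sym (prefixᵇ-swap a k u v)) (prefixᵇ-complete u v p))

swap-≺ : ∀ a k {u v} → u ≺ v → swap a k u ≺ swap a k v
swap-≺ a k {u} {v} (p , lt) =
  swap-prefix a k p , subst₂ _<_ (sym (length-swap a k u)) (sym (length-swap a k v)) lt

swap-≺⁻ : ∀ a k {u v} → swap a k u ≺ swap a k v → u ≺ v
swap-≺⁻ a k {u} {v} p = subst₂ _≺_ (swap-involutive a k u) (swap-involutive a k v) (swap-≺ a k p)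

swap-meet : ∀ a k u v → swap a k (meet _≟ℕ_ u v) ≡ meet _≟ℕ_ (swap a k u) (swap a k v)
swap-meet [] k [] v = refl
swap-meet [] k (y ∷ us) [] = refl
swap-meet [] k (y ∷ us) (z ∷ vs) with y ≟ℕ z
... | yes refl = sym (meet-∷-≡ _≟ℕ_ us vs refl)
... | no y≢z = sym (meet-∷-≢ _≟ℕ_ us vs (y≢z ∘ swapEntry-injective k))
swap-meet (a ∷ as) k [] v = refl
swap-meet (a ∷ as) k (y ∷ us) [] = sym (meet-[]ʳ _≟ℕ_ (swap (a ∷ as) k (y ∷ us)))
swap-meet (a ∷ as) k (y ∷ us) (z ∷ vs) with y ≟ℕ z
... | no y≢z with swap-∷-head a as k y us | swap-∷-head a as k z vs
...   | ys′ , eq₁ | zs′ , eq₂ rewrite eq₁ | eq₂ = sym (meet-∷-≢ _≟ℕ_ ys′ zs′ y≢z)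
swap-meet (a ∷ as) k (y ∷ us) (.y ∷ vs) | yes refl with a ≟ℕ y
... | no a≢y rewrite swap-∷-≢ as k us a≢y | swap-∷-≢ as k vs a≢y | swap-∷-≢ as k (meet _≟ℕ_ us vs) a≢y =
  sym (meet-∷-≡ _≟ℕ_ us vs refl)
... | yes refl = begin
  swap (a ∷ as) k (a ∷ meet _≟ℕ_ us vs)                     ≡⟨ swap-∷-≡ a as k (meet _≟ℕ_ us vs) ⟩
  a ∷ swap as k (meet _≟ℕ_ us vs)                           ≡⟨ cong (a ∷_) (swap-meet as k us vs) ⟩
  a ∷ meet _≟ℕ_ (swap as k us) (swap as k vs)               ≡⟨ meet-∷-≡ _≟ℕ_ _ _ refl ⟨
  meet _≟ℕ_ (a ∷ swap as k us) (a ∷ swap as k vs)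
    ≡⟨ cong₂ (meet _≟ℕ_) (swap-∷-≡ a as k us) (swap-∷-≡ a as k vs) ⟨
  meet _≟ℕ_ (swap (a ∷ as) k (a ∷ us)) (swap (a ∷ as) k (a ∷ vs)) ∎
  where open ≡-Reasoning

TreeEmbeds-swap : ∀ {ℓ d B} a k → TreeEmbeds ℓ d B → TreeEmbeds ℓ d (map (swap a k) B)
TreeEmbeds-swap a k (f , E) = swap a k ∘ f , record
  { into = λ t t∈ → let (b , b∈ , p) = into t t∈ in swap a k b , ∈-map⁺ (swap a k) b∈ , swap-prefix a k p
  ; injective = λ t t′ t∈ t′∈ → injective t t′ t∈ t′∈ ∘ swap-injective a k
  ; pres-≺ = λ t t′ t∈ t′∈ → swap-≺ a k ∘ proj₁ (pres-≺ t t′ t∈ t′∈) , proj₂ (pres-≺ t t′ t∈ t′∈) ∘ swap-≺⁻ a k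
  ; pres-∧ = λ t t′ t∈ t′∈ → trans (cong (swap a k) (pres-∧ t t′ t∈ t′∈)) (swap-meet a k (f t) (f t′))
  }
  where open IsEmbedding E

TreeEmbeds-swap⇔ : ∀ {ℓ d} B a k → TreeEmbeds ℓ d B ⇔ TreeEmbeds ℓ d (map (swap a k) B)
TreeEmbeds-swap⇔ B a k = mk⇔ (TreeEmbeds-swap a k)
  (subst (TreeEmbeds _ _) (map-swap-involutive a k B) ∘ TreeEmbeds-swap a k)

∈-restrict⁻ : ∀ B x {y} → y ∈ restrict B x → y ∈ B × IsPrefix x y
∈-restrict⁻ B x {y} y∈ = let (y∈B , t) = ∈-filter⁻ _ y∈ in y∈B , prefixᵇ-sound x y t

∈-restrict⁺ : ∀ B x {y} → y ∈ B → IsPrefix x y → y ∈ restrict B x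
∈-restrict⁺ B x {y} y∈B p = ∈-filter⁺ _ y∈B (prefixᵇ-complete x y p)

restrict-[] : ∀ B → restrict B [] ≡ B
restrict-[] [] = refl
restrict-[] (b ∷ B) = cong (b ∷_) (restrict-[] B)

restrict-antitone : ∀ B u v {y} → IsPrefix u v → y ∈ restrict B v → y ∈ restrict B u
restrict-antitone B u v u⊑v y∈ = let (y∈B , v⊑y) = ∈-restrict⁻ B v y∈ in ∈-restrict⁺ B u y∈B (prefix-trans u⊑v v⊑y)

restrict-∷ : ∀ b B x → restrict (b ∷ B) x ≡ (if prefixᵇ x b then b ∷ restrict B x else restrict B x)
restrict-∷ b B x with prefixᵇ x b
... | true = refl
... | false = refl

restrict-map-swap : ∀ a k B x → restrict (map (swap a k) B) x ≡ map (swap a k) (restrict B (swap a k x))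
restrict-map-swap a k [] x = refl
restrict-map-swap a k (b ∷ B) x
  rewrite restrict-∷ (swap a k b) (map (swap a k) B) x | restrict-∷ b B (swap a k x)
        | sym (swap-involutive a k x) | prefixᵇ-swap a k (swap a k x) b | swap-involutive a k x
  with prefixᵇ (swap a k x) b
... | true = cong (swap a k b ∷_) (restrict-map-swap a k B x)
... | false = restrict-map-swap a k B x

_≟ᴸ_ : DecidableEquality (List (List ℕ))
_≟ᴸ_ = ≡-dec (≡-dec _≟ℕ_)

+-≡⇒-≡ : ∀ s′ p s q → s′ ℤ.+ p ≡ s ℤ.+ q → s′ - q ≡ s - p
+-≡⇒-≡ s′ p s q eq = begin
  s′ - q                    ≡⟨ add-cancel s′ p q ⟨
  (s′ ℤ.+ p) - (p ℤ.+ q)    ≡⟨ cong (_- (p ℤ.+ q)) eq ⟩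
  (s ℤ.+ q) - (p ℤ.+ q)     ≡⟨ cong (λ r → (s ℤ.+ q) - r) (ℤP.+-comm p q) ⟩
  (s ℤ.+ q) - (q ℤ.+ p)     ≡⟨ add-cancel s q p ⟩
  s - p                     ∎
  where
  open ≡-Reasoning
  add-cancel : ∀ i j k → (i ℤ.+ j) - (j ℤ.+ k) ≡ i - k
  add-cancel = solve-∀

module Norms (ℓ : ℕ) where

  private
    ‖_‖ : List ℕ → ℕ
    ‖_‖ = nodeNorm ℓ

    big? : (x : ℕ) → Dec (ℓ ∸ 1 ≤ x)
    big? x = (ℓ ∸ 1) ≤? x

  nodeNorm-++ : ∀ u v → ‖ u ++ v ‖ ≡ ‖ u ‖ + ‖ v ‖
  nodeNorm-++ u v = trans (cong length (filter-++ big? u v)) (length-++ (filter big? u))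

  nodeNorm-∷-big : ∀ {x} u → ℓ ∸ 1 ≤ x → ‖ x ∷ u ‖ ≡ suc ‖ u ‖
  nodeNorm-∷-big u big = cong length (filter-accept big? big)

  nodeNorm-∷-small : ∀ {x} u → ¬ ℓ ∸ 1 ≤ x → ‖ x ∷ u ‖ ≡ ‖ u ‖
  nodeNorm-∷-small u small = cong length (filter-reject big? small)

  nodeNorm-prefix : ∀ {u v} → IsPrefix u v → ‖ u ‖ ≤ ‖ v ‖
  nodeNorm-prefix {u} (c , refl) rewrite nodeNorm-++ u c = ℕP.m≤m+n _ _

  nodeNorm-snoc-big : ∀ u {x} → ℓ ∸ 1 ≤ x → ‖ u ++ [ x ] ‖ ≡ suc ‖ u ‖
  nodeNorm-snoc-big u big =
    trans (nodeNorm-++ u _) (trans (cong (_+_ ‖ u ‖) (nodeNorm-∷-big [] big)) (ℕP.+-comm ‖ u ‖ 1))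

  ≤-setNorm : ∀ {A y} → y ∈ A → + ‖ y ‖ ℤ.≤ setNorm ℓ A
  ≤-setNorm (here refl) = ℤP.i≤i⊔j _ _
  ≤-setNorm {a ∷ A} (there y∈) = ℤP.≤-trans (≤-setNorm {A} y∈) (ℤP.i≤j⊔i _ _)

  -1≤setNorm : ∀ A → -[1+ 0 ] ℤ.≤ setNorm ℓ A
  -1≤setNorm [] = ℤP.≤-refl
  -1≤setNorm (a ∷ A) = ℤP.≤-trans (-1≤setNorm A) (ℤP.i≤j⊔i _ _)

  setNorm-mono : ∀ A {A′} → (∀ {y} → y ∈ A → y ∈ A′) → setNorm ℓ A ℤ.≤ setNorm ℓ A′
  setNorm-mono [] {A′} _ = -1≤setNorm A′
  setNorm-mono (a ∷ A) A⊆A′ = ℤP.⊔-lub (≤-setNorm (A⊆A′ (here refl))) (setNorm-mono A (A⊆A′ ∘ there))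

  argmax : List (List ℕ) → List ℕ
  argmax [] = []
  argmax (y ∷ A) with setNorm ℓ A ℤ.≤? + ‖ y ‖
  ... | yes _ = y
  ... | no _ = argmax A

  argmax-spec : ∀ A → A ≢ [] → argmax A ∈ A × setNorm ℓ A ≡ + ‖ argmax A ‖
  argmax-spec [] A≢[] = ⊥-elim (A≢[] refl)
  argmax-spec (y ∷ A) _ with setNorm ℓ A ℤ.≤? + ‖ y ‖
  ... | yes A≤y = here refl , ℤP.i≥j⇒i⊔j≡i A≤y
  ... | no A≰y with A ≟ᴸ []
  ...   | yes refl = ⊥-elim (A≰y ℤ.-≤+)
  ...   | no A≢[] = let (max∈ , eq) = argmax-spec A A≢[]
                    in there max∈ , trans (ℤP.i≤j⇒i⊔j≡j (ℤP.<⇒≤ (ℤP.≰⇒> A≰y))) eq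

  setNorm-map-shift : ∀ (g : List ℕ → List ℕ) p q A → A ≢ [] →
    (∀ {y} → y ∈ A → ‖ g y ‖ + p ≡ ‖ y ‖ + q) →
    setNorm ℓ (map g A) ℤ.+ + p ≡ setNorm ℓ A ℤ.+ + q
  setNorm-map-shift g p q [] A≢[] _ = ⊥-elim (A≢[] refl)
  setNorm-map-shift g p q (y ∷ []) _ shift = begin
    (+ ‖ g y ‖ ⊔ -[1+ 0 ]) ℤ.+ + p  ≡⟨ cong (ℤ._+ + p) (ℤP.i≥j⇒i⊔j≡i (ℤ.-≤+ {0} {‖ g y ‖})) ⟩
    + (‖ g y ‖ + p)                 ≡⟨ cong +_ (shift (here refl)) ⟩
    + (‖ y ‖ + q)                   ≡⟨ cong (ℤ._+ + q) (ℤP.i≥j⇒i⊔j≡i (ℤ.-≤+ {0} {‖ y ‖})) ⟨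
    (+ ‖ y ‖ ⊔ -[1+ 0 ]) ℤ.+ + q    ∎
    where open ≡-Reasoning
  setNorm-map-shift g p q (y ∷ A@(_ ∷ _)) _ shift = begin
    (+ ‖ g y ‖ ⊔ setNorm ℓ (map g A)) ℤ.+ + p          ≡⟨ +-distribʳ-⊔ (+ p) (+ ‖ g y ‖) (setNorm ℓ (map g A)) ⟩
    + (‖ g y ‖ + p) ⊔ (setNorm ℓ (map g A) ℤ.+ + p)    ≡⟨ cong₂ _⊔_ (cong +_ (shift (here refl)))
                                                          (setNorm-map-shift g p q A (λ ()) (shift ∘ there)) ⟩
    + (‖ y ‖ + q) ⊔ (setNorm ℓ A ℤ.+ + q)              ≡⟨ +-distribʳ-⊔ (+ q) (+ ‖ y ‖) (setNorm ℓ A) ⟨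
    (+ ‖ y ‖ ⊔ setNorm ℓ A) ℤ.+ + q                    ∎
    where
    open ≡-Reasoning
    +-distribʳ-⊔ : ∀ r i j → (i ⊔ j) ℤ.+ r ≡ (i ℤ.+ r) ⊔ (j ℤ.+ r)
    +-distribʳ-⊔ r = ℤP.mono-≤-distrib-⊔ (ℤP.+-monoˡ-≤ r)

  score-root : ∀ B → score ℓ B [] ≡ setNorm ℓ B
  score-root B rewrite restrict-[] B = ℤP.+-identityʳ (setNorm ℓ B)

  score-antitone : ∀ B {x y} → IsPrefix x y → score ℓ B y ℤ.≤ score ℓ B x
  score-antitone B {x} {y} x⊑y = ℤP.+-mono-≤ (setNorm-mono (restrict B y) (restrict-antitone B x y x⊑y))
                                      (ℤP.neg-mono-≤ (ℤ.+≤+ (nodeNorm-prefix x⊑y)))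

  score-≥-suffix : ∀ B x v → x ++ v ∈ B → + ‖ v ‖ ℤ.≤ score ℓ B x
  score-≥-suffix B x v x++v∈ = subst (ℤ._≤ score ℓ B x) (cancel (+ ‖ x ‖) (+ ‖ v ‖))
    (ℤP.+-monoˡ-≤ (ℤ.- + ‖ x ‖)
      (subst (λ n → + n ℤ.≤ setNorm ℓ (restrict B x)) (nodeNorm-++ x v)
        (≤-setNorm (∈-restrict⁺ B x x++v∈ (prefix-++ x v)))))
    where
    cancel : ∀ i j → i ℤ.+ j - i ≡ j
    cancel = solve-∀

  score-suc-big-child : ∀ B r {x} → ℓ ∸ 1 ≤ x → + 1 ℤ.+ score ℓ B (r ++ [ x ]) ℤ.≤ score ℓ B r
  score-suc-big-child B r {x} big = begin
    + 1 ℤ.+ (setNorm ℓ (restrict B (r ++ [ x ])) - + ‖ r ++ [ x ] ‖)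
      ≡⟨ cong (λ n → + 1 ℤ.+ (setNorm ℓ (restrict B (r ++ [ x ])) - + n)) (nodeNorm-snoc-big r big) ⟩
    + 1 ℤ.+ (setNorm ℓ (restrict B (r ++ [ x ])) - (+ 1 ℤ.+ + ‖ r ‖))
      ≡⟨ cancel (setNorm ℓ (restrict B (r ++ [ x ]))) (+ ‖ r ‖) ⟩
    setNorm ℓ (restrict B (r ++ [ x ])) - + ‖ r ‖
      ≤⟨ ℤP.+-monoˡ-≤ (ℤ.- + ‖ r ‖)
           (setNorm-mono (restrict B (r ++ [ x ])) (restrict-antitone B r (r ++ [ x ]) (prefix-++ r [ x ]))) ⟩
    score ℓ B r ∎
    where
    open ℤP.≤-Reasoning
    cancel : ∀ s i → + 1 ℤ.+ (s - (+ 1 ℤ.+ i)) ≡ s - i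
    cancel = solve-∀

  restrict≢[]⇒score-nonneg : ∀ B x → restrict B x ≢ [] → + 0 ℤ.≤ score ℓ B x
  restrict≢[]⇒score-nonneg B x ne =
    let (max∈ , _) = argmax-spec (restrict B x) ne
        (max∈B , (v , x++v≡max)) = ∈-restrict⁻ B x max∈
    in ℤP.≤-trans (ℤ.+≤+ z≤n) (score-≥-suffix B x v (subst (_∈ B) (sym x++v≡max) max∈B))

  restrict≡[]⇒score≡ : ∀ B x → restrict B x ≡ [] → score ℓ B x ≡ -[1+ 0 ] - + ‖ x ‖
  restrict≡[]⇒score≡ B x eq rewrite eq = refl

  restrict≡[]⇒score-neg : ∀ B x → restrict B x ≡ [] → score ℓ B x ℤ.< + 0
  restrict≡[]⇒score-neg B x eq rewrite restrict≡[]⇒score≡ B x eq with ‖ x ‖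
  ... | zero = ℤ.-<+
  ... | suc _ = ℤ.-<+

  score-nonneg⇒restrict≢[] : ∀ B x → + 0 ℤ.≤ score ℓ B x → restrict B x ≢ []
  score-nonneg⇒restrict≢[] B x nonneg eq = ℤP.<⇒≱ (restrict≡[]⇒score-neg B x eq) nonneg

  score-neg⇒restrict≡[] : ∀ B x → score ℓ B x ℤ.< + 0 → restrict B x ≡ []
  score-neg⇒restrict≡[] B x neg with restrict B x ≟ᴸ []
  ... | yes eq = eq
  ... | no ne = ⊥-elim (ℤP.<⇒≱ neg (restrict≢[]⇒score-nonneg B x ne))

  heaviestSuffix : List (List ℕ) → List ℕ → List ℕ
  heaviestSuffix B c = drop (length c) (argmax (restrict B c))

  heaviestSuffix-spec : ∀ B c → restrict B c ≢ [] →
    c ++ heaviestSuffix B c ∈ B × score ℓ B c ≡ + ‖ heaviestSuffix B c ‖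
  heaviestSuffix-spec B c ne with argmax-spec (restrict B c) ne
  ... | max∈ , setNorm≡ with ∈-restrict⁻ B c max∈
  ...   | max∈B , (v , c++v≡max) = subst (_∈ B) (sym c++v≡heaviest) max∈B , score≡
    where
    heaviest≡v : heaviestSuffix B c ≡ v
    heaviest≡v = trans (cong (drop (length c)) (sym c++v≡max)) (drop-length-++ c v)
    c++v≡heaviest : c ++ heaviestSuffix B c ≡ argmax (restrict B c)
    c++v≡heaviest = trans (cong (c ++_) heaviest≡v) c++v≡max
    score≡ : score ℓ B c ≡ + ‖ heaviestSuffix B c ‖
    score≡ = begin
      setNorm ℓ (restrict B c) - + ‖ c ‖           ≡⟨ cong (_- + ‖ c ‖) setNorm≡ ⟩
      + ‖ argmax (restrict B c) ‖ - + ‖ c ‖        ≡⟨ cong (λ w → + ‖ w ‖ - + ‖ c ‖) c++v≡heaviest ⟨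
      + ‖ c ++ heaviestSuffix B c ‖ - + ‖ c ‖      ≡⟨ cong (λ n → + n - + ‖ c ‖) (nodeNorm-++ c _) ⟩
      + ‖ c ‖ ℤ.+ + ‖ heaviestSuffix B c ‖ - + ‖ c ‖  ≡⟨ cancel (+ ‖ c ‖) _ ⟩
      + ‖ heaviestSuffix B c ‖                     ∎
      where
      open ≡-Reasoning
      cancel : ∀ i j → i ℤ.+ j - i ≡ j
      cancel = solve-∀

  module _ (a : List ℕ) (k : ℕ) where

    private
      σ : List ℕ → List ℕ
      σ = swap a k

    restrict-map-swap-≡[] : ∀ B x → restrict B (σ x) ≡ [] → restrict (map σ B) x ≡ []
    restrict-map-swap-≡[] B x eq rewrite restrict-map-swap a k B x | eq = refl

    -- Outside Č B the score is the junk value −1 − ‖x‖, which a swap need not preserve.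
    score-map-swap : ∀ B x → length a < length x → restrict B (σ x) ≢ [] →
      score ℓ (map σ B) x ≡ score ℓ B (σ x)
    score-map-swap B x a<x ne rewrite restrict-map-swap a k B x =
      +-≡⇒-≡ (setNorm ℓ (map σ (restrict B (σ x)))) (+ ‖ σ x ‖) (setNorm ℓ (restrict B (σ x))) (+ ‖ x ‖)
        (setNorm-map-shift σ (‖ σ x ‖) (‖ x ‖) (restrict B (σ x)) ne shift)
      where
      a<σx : length a < length (σ x)
      a<σx = subst (length a <_) (sym (length-swap a k x)) a<x
      shift : ∀ {y} → y ∈ restrict B (σ x) → ‖ σ y ‖ + ‖ σ x ‖ ≡ ‖ y ‖ + ‖ x ‖
      shift y∈ with ∈-restrict⁻ B (σ x) y∈
      ... | _ , (w , refl)
        rewrite swap-++ a k (σ x) w (ℕP.<⇒≤ a<σx) (λ eq → ℕP.<-irrefl (cong length (sym eq)) a<σx)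
              | swap-involutive a k x | nodeNorm-++ x w | nodeNorm-++ (σ x) w =
        rotate (‖ x ‖) (‖ w ‖) (‖ σ x ‖)
        where
        rotate : ∀ (i j l : ℕ) → i + j + l ≡ l + j + i
        rotate = ℕSolver.solve-∀

    score-map-swap-nonneg : ∀ B x → length a < length x → + 0 ℤ.≤ score ℓ B (σ x) →
      score ℓ (map σ B) x ≡ score ℓ B (σ x)
    score-map-swap-nonneg B x a<x nonneg = score-map-swap B x a<x (score-nonneg⇒restrict≢[] B (σ x) nonneg)

    score-map-swap-neg : ∀ B x → score ℓ B (σ x) ℤ.< + 0 → score ℓ (map σ B) x ℤ.< + 0
    score-map-swap-neg B x neg = restrict≡[]⇒score-neg (map σ B) x
      (restrict-map-swap-≡[] B x (score-neg⇒restrict≡[] B (σ x) neg))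

    score-map-swap-fixed : ∀ B x → length a < length x → σ x ≡ x → score ℓ (map σ B) x ≡ score ℓ B x
    score-map-swap-fixed B x a<x σx≡x with restrict B x ≟ᴸ []
    ... | yes eq = trans (restrict≡[]⇒score≡ (map σ B) x (restrict-map-swap-≡[] B x (trans (cong (restrict B) σx≡x) eq)))
                         (sym (restrict≡[]⇒score≡ B x eq))
    ... | no ne = trans (score-map-swap B x a<x (subst (λ y → restrict B y ≢ []) (sym σx≡x) ne))
                        (cong (score ℓ B) σx≡x)

-- One round of normalization sorts the children of a node

foldl-upTo-induction : {X : Set} (f : X → ℕ → X) (P : ℕ → X → Set) → ∀ K →
  (∀ i x → i < K → P i x → P (suc i) (f x i)) → ∀ x → P 0 x → P K (foldl f x (upTo K))
foldl-upTo-induction f P zero _ x P0 = P0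
foldl-upTo-induction f P (suc K) step x P0 =
  subst (λ is → P (suc K) (foldl f x is)) (upTo-∷ʳ K)
    (subst (P (suc K)) (sym (foldl-∷ʳ f x K (upTo K)))
      (step K _ ℕP.≤-refl (foldl-upTo-induction f P K (λ i y i<K → step i y (ℕP.m<n⇒m<1+n i<K)) x P0)))

<∸1⇒suc< : ∀ {i x} → i < x ∸ 1 → suc i < x
<∸1⇒suc< {x = suc x} i<x = s≤s i<x

∸1≡pred : ∀ x → x ∸ 1 ≡ ℕ.pred x
∸1≡pred zero = refl
∸1≡pred (suc x) = refl

swapEntry-≤ : ∀ k {q p} → q ≤ p → suc k ≤ p → swapEntry k q ≤ p
swapEntry-≤ k {q} q≤p 1+k≤p with q ≟ℕ k | q ≟ℕ suc k
... | yes refl | _ rewrite swapEntry-k q = 1+k≤p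
... | no _ | yes refl rewrite swapEntry-suc k = ℕP.≤-trans (ℕP.n≤1+n k) 1+k≤p
... | no q≢k | no q≢1+k rewrite swapEntry-other k q q≢k q≢1+k = q≤p

module BubbleSort (ℓ m : ℕ) (a : List ℕ) where
  open Norms ℓ

  childScore : List (List ℕ) → ℕ → ℤ
  childScore B i = score ℓ B (a ++ [ i ])

  -- Bubble-sort invariants: in the j-th pass the k-loop carries the least nonnegative score
  -- among the children 0, …, k to position k, and positions ≥ m − j are already final.
  MinAt : List (List ℕ) → ℕ → Set
  MinAt B p = + 0 ℤ.≤ childScore B p → ∀ q → q ≤ p → childScore B p ℤ.≤ childScore B q

  SortedFrom : ℕ → List (List ℕ) → Set
  SortedFrom f B = ∀ p → f ≤ p → p < m → MinAt B p

  module _ (B : List (List ℕ)) (k : ℕ) where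

    private
      B′ : List (List ℕ)
      B′ = map (swap a k) B

      child-swap : ∀ q → swap a k (a ++ [ q ]) ≡ a ++ [ swapEntry k q ]
      child-swap q = swap-child a k q []

    childScore-swap : ∀ q {q′} → swapEntry k q ≡ q′ → + 0 ℤ.≤ childScore B q′ → childScore B′ q ≡ childScore B q′
    childScore-swap q refl nonneg =
      trans (score-map-swap-nonneg a k B (a ++ [ q ]) (length-<-snoc a q)
               (subst (λ y → + 0 ℤ.≤ score ℓ B y) (sym (child-swap q)) nonneg))
            (cong (score ℓ B) (child-swap q))

    childScore-swap-neg : ∀ q {q′} → swapEntry k q ≡ q′ → childScore B q′ ℤ.< + 0 → childScore B′ q ℤ.< + 0
    childScore-swap-neg q refl neg =
      score-map-swap-neg a k B (a ++ [ q ]) (subst (λ y → score ℓ B y ℤ.< + 0) (sym (child-swap q)) neg)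

    childScore-swap-fixed : ∀ q → swapEntry k q ≡ q → childScore B′ q ≡ childScore B q
    childScore-swap-fixed q fixed = score-map-swap-fixed a k B (a ++ [ q ]) (length-<-snoc a q)
      (trans (child-swap q) (cong (λ y → a ++ [ y ]) fixed))

    kStep-cases : (kStep ℓ a B k ≡ B × childScore B (suc k) ℤ.≤ childScore B k)
                ⊎ (kStep ℓ a B k ≡ B′ × childScore B k ℤ.< childScore B (suc k))
    kStep-cases with childScore B (suc k) ℤ.≤? childScore B k
    ... | yes le = inj₁ (refl , le)
    ... | no nle = inj₂ (refl , ℤP.≰⇒> nle)

  minAt-zero : ∀ B → MinAt B 0
  minAt-zero B _ q q≤0 rewrite ℕP.n≤0⇒n≡0 q≤0 = ℤP.≤-refl

  kStep-minAt : ∀ B k → MinAt B k → MinAt (kStep ℓ a B k) (suc k)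
  kStep-minAt B k minAt with kStep-cases B k
  ... | inj₁ (eq , S[1+k]≤S[k]) rewrite eq = kept
    where
    kept : MinAt B (suc k)
    kept nonneg q q≤1+k with q ≟ℕ suc k
    ... | yes refl = ℤP.≤-refl
    ... | no q≢1+k = ℤP.≤-trans S[1+k]≤S[k]
      (minAt (ℤP.≤-trans nonneg S[1+k]≤S[k]) q (ℕ.s≤s⁻¹ (ℕP.≤∧≢⇒< q≤1+k q≢1+k)))
  ... | inj₂ (eq , S[k]<S[1+k]) rewrite eq = swapped
    where
    S S′ : ℕ → ℤ
    S = childScore B
    S′ = childScore (map (swap a k) B)
    swapped : MinAt (map (swap a k) B) (suc k)
    swapped nonneg′ q q≤1+k = goal
      where
      nonneg : + 0 ℤ.≤ S k
      nonneg = ℤP.≮⇒≥ (λ neg → ℤP.<⇒≱ (childScore-swap-neg B k (suc k) (swapEntry-suc k) neg) nonneg′)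
      S′[1+k]≡S[k] : S′ (suc k) ≡ S k
      S′[1+k]≡S[k] = childScore-swap B k (suc k) (swapEntry-suc k) nonneg
      goal : S′ (suc k) ℤ.≤ S′ q
      goal with q ≟ℕ suc k | q ≟ℕ k
      ... | yes refl | _ = ℤP.≤-refl
      ... | no _ | yes refl = begin
        S′ (suc k) ≡⟨ S′[1+k]≡S[k] ⟩
        S k        ≤⟨ ℤP.<⇒≤ S[k]<S[1+k] ⟩
        S (suc k)  ≡⟨ childScore-swap B k k (swapEntry-k k) (ℤP.≤-trans nonneg (ℤP.<⇒≤ S[k]<S[1+k])) ⟨
        S′ k       ∎
        where open ℤP.≤-Reasoning
      ... | no q≢1+k | no q≢k = begin
        S′ (suc k) ≡⟨ S′[1+k]≡S[k] ⟩
        S k        ≤⟨ minAt nonneg q (ℕ.s≤s⁻¹ (ℕP.≤∧≢⇒< q≤1+k q≢1+k)) ⟩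
        S q        ≡⟨ childScore-swap-fixed B k q (swapEntry-other k q q≢k q≢1+k) ⟨
        S′ q       ∎
        where open ℤP.≤-Reasoning

  kStep-sortedFrom : ∀ f B k → suc k < f → SortedFrom f B → SortedFrom f (kStep ℓ a B k)
  kStep-sortedFrom f B k 1+k<f sorted with kStep-cases B k
  ... | inj₁ (eq , _) rewrite eq = sorted
  ... | inj₂ (eq , _) rewrite eq = swapped
    where
    S S′ : ℕ → ℤ
    S = childScore B
    S′ = childScore (map (swap a k) B)
    swapped : SortedFrom f (map (swap a k) B)
    swapped p f≤p p<m nonneg′ q q≤p = begin
      S′ p                 ≡⟨ S′p≡Sp ⟩
      S p                  ≤⟨ Sp≤Sq′ ⟩
      S (swapEntry k q)    ≡⟨ childScore-swap B k q refl (ℤP.≤-trans nonneg Sp≤Sq′) ⟨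
      S′ q                 ∎
      where
      open ℤP.≤-Reasoning
      1+k<p : suc k < p
      1+k<p = ℕP.<-≤-trans 1+k<f f≤p
      S′p≡Sp : S′ p ≡ S p
      S′p≡Sp = childScore-swap-fixed B k p (swapEntry-other k p
        (λ p≡k → ℕP.<-asym (subst (suc k <_) p≡k 1+k<p) (ℕP.n<1+n k))
        (λ p≡1+k → ℕP.<-irrefl (sym p≡1+k) 1+k<p))
      nonneg : + 0 ℤ.≤ S p
      nonneg = subst (+ 0 ℤ.≤_) S′p≡Sp nonneg′
      Sp≤Sq′ : S p ℤ.≤ S (swapEntry k q)
      Sp≤Sq′ = sorted p f≤p p<m nonneg (swapEntry k q) (swapEntry-≤ k q≤p (ℕP.<⇒≤ 1+k<p))

  jStep-invariant : ∀ j B → SortedFrom (m ∸ j) B →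
    SortedFrom (m ∸ j) (jStep m ℓ a B j) × MinAt (jStep m ℓ a B j) (m ∸ j ∸ 1)
  jStep-invariant j B sorted =
    foldl-upTo-induction (kStep ℓ a) (λ i X → SortedFrom (m ∸ j) X × MinAt X i) (m ∸ j ∸ 1)
      (λ i X i<K (sortedX , minAtX) → kStep-sortedFrom (m ∸ j) X i (<∸1⇒suc< i<K) sortedX , kStep-minAt X i minAtX)
      B (sorted , minAt-zero B)

  jStep-sortedFrom : ∀ j B → SortedFrom (m ∸ j) B → SortedFrom (m ∸ suc j) (jStep m ℓ a B j)
  jStep-sortedFrom j B sorted p m∸[1+j]≤p p<m with m ∸ j ≤? p
  ... | yes m∸j≤p = proj₁ (jStep-invariant j B sorted) p m∸j≤p p<m
  ... | no m∸j≰p = subst (MinAt (jStep m ℓ a B j)) (sym p≡K) (proj₂ (jStep-invariant j B sorted))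
    where
    K≡m∸[1+j] : m ∸ j ∸ 1 ≡ m ∸ suc j
    K≡m∸[1+j] = trans (∸1≡pred (m ∸ j)) (ℕP.pred[m∸n]≡m∸[1+n] m j)
    p≡K : p ≡ m ∸ j ∸ 1
    p≡K = ℕP.≤-antisym
      (subst (p ≤_) (sym (∸1≡pred (m ∸ j))) (ℕP.<⇒≤pred (ℕP.≰⇒> m∸j≰p)))
      (subst (_≤ p) (sym K≡m∸[1+j]) m∸[1+j]≤p)

  iStep-sorted : ∀ B → SortedFrom 0 (iStep m ℓ B a)
  iStep-sorted B zero _ _ = minAt-zero (iStep m ℓ B a)
  iStep-sorted B (suc p) _ p<m = sortedFromLast (suc p) (ℕP.≤-trans (m∸[m∸1]≤1 m) (s≤s z≤n)) p<m
    where
    m∸[m∸1]≤1 : ∀ m → m ∸ (m ∸ 1) ≤ 1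
    m∸[m∸1]≤1 zero = z≤n
    m∸[m∸1]≤1 (suc m) = ℕP.≤-reflexive (ℕP.m+n∸n≡m 1 m)
    sortedFromLast : SortedFrom (m ∸ (m ∸ 1)) (iStep m ℓ B a)
    sortedFromLast = foldl-upTo-induction (jStep m ℓ a) (λ j X → SortedFrom (m ∸ j) X) (m ∸ 1)
      (λ j X _ → jStep-sortedFrom j X) B (λ p m≤p p<m → ⊥-elim (ℕP.<-irrefl refl (ℕP.<-≤-trans p<m m≤p)))

  iStep-preserves : (Q : List (List ℕ) → Set) → (∀ B k → suc k < m → Q B → Q (map (swap a k) B)) →
    ∀ B → Q B → Q (iStep m ℓ B a)
  iStep-preserves Q swap-preserves = foldl-upTo-induction (jStep m ℓ a) (λ _ → Q) (m ∸ 1) jStep-preserves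
    where
    kStep-preserves : ∀ j i X → i < m ∸ j ∸ 1 → Q X → Q (kStep ℓ a X i)
    kStep-preserves j i X i<K QX with kStep-cases X i
    ... | inj₁ (eq , _) rewrite eq = QX
    ... | inj₂ (eq , _) rewrite eq = swap-preserves X i (ℕP.<-≤-trans (<∸1⇒suc< i<K) (ℕP.m∸n≤m m j)) QX
    jStep-preserves : ∀ j X → j < m ∸ 1 → Q X → Q (jStep m ℓ a X j)
    jStep-preserves j X _ = foldl-upTo-induction (kStep ℓ a) (λ _ → Q) (m ∸ j ∸ 1) (kStep-preserves j) X

-- Normalization sorts the children of every node

module Normalization (ℓ m n : ℕ) where
  open Norms ℓ

  IsNode : List ℕ → Set
  IsNode r = length r < n × Entries< m r

  ChildrenSorted : List (List ℕ) → List ℕ → Set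
  ChildrenSorted B r = BubbleSort.SortedFrom ℓ m r 0 B

  seqs-complete : ∀ r → Entries< m r → r ∈ seqs m (length r)
  seqs-complete [] _ = here refl
  seqs-complete (x ∷ r) r<m = ∈-concatMap⁺ (λ y → map (y ∷_) (seqs m (length r)))
    (lose (∈-upTo⁺ (r<m x (here refl)))
    (∈-map⁺ (x ∷_) (seqs-complete r (λ z → r<m z ∘ there))))

  IsNode⇒∈nodesLt : ∀ {r} → IsNode r → r ∈ nodesLt m n
  IsNode⇒∈nodesLt {r} (r<n , r<m) = ∈-concatMap⁺ (seqs m) (lose (∈-upTo⁺ r<n) (seqs-complete r r<m))

  IsNode-swap : ∀ a k {r} → suc k < m → IsNode r → IsNode (swap a k r)
  IsNode-swap a k {r} 1+k<m (r<n , r<m) =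
    subst (_< n) (sym (length-swap a k r)) r<n , swap-entries< a k r 1+k<m r<m

  IsLeafSet-swap : ∀ a k {B} → suc k < m → IsLeafSet m n B → IsLeafSet m n (map (swap a k) B)
  IsLeafSet-swap a k 1+k<m leaves b b∈ with ∈-map⁻ (swap a k) b∈
  ... | y , y∈ , refl = trans (length-swap a k y) (proj₁ (leaves y y∈)) , swap-entries< a k y 1+k<m (proj₂ (leaves y y∈))

  sorted-swap : ∀ a k B r → length a ≤ length r → r ≢ a →
    ChildrenSorted B (swap a k r) → ChildrenSorted (map (swap a k) B) r
  sorted-swap a k B r a≤r r≢a sorted p _ p<m nonneg′ q q≤p = begin
    S′ p ≡⟨ S′≡Sσ p (Sσ-nonneg p nonneg′) ⟩
    Sσ p ≤⟨ Sσp≤Sσq ⟩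
    Sσ q ≡⟨ S′≡Sσ q (ℤP.≤-trans (Sσ-nonneg p nonneg′) Sσp≤Sσq) ⟨
    S′ q ∎
    where
    open ℤP.≤-Reasoning
    S′ Sσ : ℕ → ℤ
    S′ i = score ℓ (map (swap a k) B) (r ++ [ i ])
    Sσ i = score ℓ B (swap a k r ++ [ i ])
    child-swap : ∀ i → swap a k (r ++ [ i ]) ≡ swap a k r ++ [ i ]
    child-swap i = swap-++ a k r [ i ] a≤r r≢a
    a<child : ∀ i → length a < length (r ++ [ i ])
    a<child i = ℕP.≤-<-trans a≤r (length-<-snoc r i)
    S′≡Sσ : ∀ i → + 0 ℤ.≤ Sσ i → S′ i ≡ Sσ i
    S′≡Sσ i nonneg = trans
      (score-map-swap-nonneg a k B (r ++ [ i ]) (a<child i)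
        (subst (λ y → + 0 ℤ.≤ score ℓ B y) (sym (child-swap i)) nonneg))
      (cong (score ℓ B) (child-swap i))
    Sσ-nonneg : ∀ i → + 0 ℤ.≤ S′ i → + 0 ℤ.≤ Sσ i
    Sσ-nonneg i nonneg′ = ℤP.≮⇒≥ λ neg → ℤP.<⇒≱
      (score-map-swap-neg a k B (r ++ [ i ]) (subst (λ y → score ℓ B y ℤ.< + 0) (sym (child-swap i)) neg)) nonneg′
    Sσp≤Sσq : Sσ p ℤ.≤ Sσ q
    Sσp≤Sσq = sorted p z≤n p<m (Sσ-nonneg p nonneg′) q q≤p

  LengthDescending : List (List ℕ) → Set
  LengthDescending = AllPairs (λ x y → length x ≥ length y)

  Deeper : List (List ℕ) → Set
  Deeper R = ∀ r → IsNode r → ¬ r ∈ R → ∀ {x} → x ∈ R → length x ≤ length r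

  SortedOutside : List (List ℕ) → List (List ℕ) → Set
  SortedOutside B R = ∀ r → IsNode r → ¬ r ∈ R → ChildrenSorted B r

  private
    ∉-∷ : ∀ {a r} {R : List (List ℕ)} → r ≢ a → ¬ r ∈ R → ¬ r ∈ a ∷ R
    ∉-∷ r≢a _ (here r≡a) = r≢a r≡a
    ∉-∷ _ r∉R (there r∈R) = r∉R r∈R

  -- Nodes are processed deepest first, so a swap at a moves only processed nodes, and it maps
  -- their children to the children of their images.
  SortedOutside-swap : ∀ {a R} k B → All.All (λ x → length a ≥ length x) R → Deeper (a ∷ R) → suc k < m →
    SortedOutside B (a ∷ R) → SortedOutside (map (swap a k) B) (a ∷ R)
  SortedOutside-swap {a} {R} k B a≥R deeper 1+k<m sorted r r-node r∉ =
    sorted-swap a k B r a≤r (r∉ ∘ here) (sorted (swap a k r) (IsNode-swap a k 1+k<m r-node) σr∉)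
    where
    a≤r : length a ≤ length r
    a≤r = deeper r r-node r∉ (here refl)
    σr∉ : ¬ swap a k r ∈ a ∷ R
    σr∉ σr∈ with length r ≤? length a
    ... | yes r≤a = r∉ (subst (_∈ a ∷ R) (swap-short a k r r≤a) σr∈)
    ... | no r≰a = r≰a (subst (_≤ length a) (length-swap a k r) (shallow σr∈))
      where
      shallow : ∀ {x} → x ∈ a ∷ R → length x ≤ length a
      shallow (here refl) = ℕP.≤-refl
      shallow (there x∈R) = All.lookup a≥R x∈R

  foldl-iStep-sorted : ∀ R B → LengthDescending R → Deeper R → SortedOutside B R →
    SortedOutside (foldl (iStep m ℓ) B R) []
  foldl-iStep-sorted [] B _ _ sorted = sorted
  foldl-iStep-sorted (a ∷ R) B (a≥R ∷ descending) deeper sorted =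
    foldl-iStep-sorted R (iStep m ℓ B a) descending deeper′ sorted′
    where
    deeper′ : Deeper R
    deeper′ r r-node r∉R with ≡-dec _≟ℕ_ r a
    ... | yes refl = All.lookup a≥R
    ... | no r≢a = deeper r r-node (∉-∷ r≢a r∉R) ∘ there
    sorted′ : SortedOutside (iStep m ℓ B a) R
    sorted′ r r-node r∉R with ≡-dec _≟ℕ_ r a
    ... | yes refl = BubbleSort.iStep-sorted ℓ m r B
    ... | no r≢a = BubbleSort.iStep-preserves ℓ m a (λ X → SortedOutside X (a ∷ R))
                     (λ X k → SortedOutside-swap k X a≥R deeper) B sorted r r-node (∉-∷ r≢a r∉R)

  normalize-sorted : ∀ enum B → enum ↭ nodesLt m n → LengthDescending enum →
    ∀ r → IsNode r → ChildrenSorted (normalize m ℓ enum B) r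
  normalize-sorted enum B enum↭ descending r r-node =
    foldl-iStep-sorted enum B descending vacuous vacuous r r-node (λ ())
    where
    vacuous : ∀ {P : List ℕ → Set} r → IsNode r → ¬ r ∈ enum → P r
    vacuous r r-node r∉ = ⊥-elim (r∉ (∈-resp-↭ (↭-sym enum↭) (IsNode⇒∈nodesLt r-node)))

  normalize-preserves : (Q : List (List ℕ) → Set) → (∀ X a k → suc k < m → Q X → Q (map (swap a k) X)) →
    ∀ enum B → Q B → Q (normalize m ℓ enum B)
  normalize-preserves Q swap-preserves [] B QB = QB
  normalize-preserves Q swap-preserves (a ∷ enum) B QB = normalize-preserves Q swap-preserves enum (iStep m ℓ B a)
    (BubbleSort.iStep-preserves ℓ m a Q (λ X → swap-preserves X a) B QB)

module _ {ℓ : ℕ} (f : List (Fin ℓ) → List ℕ)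
  (f-meet : ∀ t t′ → f (meet _≟F_ t t′) ≡ meet _≟ℕ_ (f t) (f t′))
  (f-≺ : ∀ t t′ → t ≺ t′ → f t ≺ f t′) where

  private
    meet≡ˡ : ∀ t t′ → f (meet _≟F_ t t′) ≡ f t → meet _≟F_ t t′ ≡ t
    meet≡ˡ t t′ eq with ≡-dec _≟F_ (meet _≟F_ t t′) t
    ... | yes meet≡t = meet≡t
    ... | no meet≢t = ⊥-elim (ℕP.<-irrefl (cong length eq)
      (proj₂ (f-≺ _ t (meet-prefixˡ _≟F_ t t′ , prefix-≢⇒length< (meet-prefixˡ _≟F_ t t′) meet≢t))))

  meet-preserving-injective : ∀ t t′ → f t ≡ f t′ → t ≡ t′
  meet-preserving-injective t t′ eq =
    trans (sym (meet≡ˡ t t′ fmeet≡ft)) (trans (meet-comm _≟F_ t t′) (meet≡ˡ t′ t fmeet≡ft′))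
    where
    fmeet≡ft : f (meet _≟F_ t t′) ≡ f t
    fmeet≡ft = trans (f-meet t t′) (trans (cong (meet _≟ℕ_ (f t)) (sym eq)) (meet-idem _≟ℕ_ (f t)))
    fmeet≡ft′ : f (meet _≟F_ t′ t) ≡ f t′
    fmeet≡ft′ = trans (f-meet t′ t) (trans (cong (meet _≟ℕ_ (f t′)) eq) (meet-idem _≟ℕ_ (f t′)))

  meet-preserving-≺⁻ : ∀ t t′ → f t ≺ f t′ → t ≺ t′
  meet-preserving-≺⁻ t t′ (ft⊑ft′ , ft<ft′) =
    t⊑t′ , prefix-≢⇒length< t⊑t′ (λ t≡t′ → ℕP.<-irrefl (cong (length ∘ f) t≡t′) ft<ft′)
    where
    t⊑t′ : IsPrefix t t′
    t⊑t′ = subst (λ s → IsPrefix s t′)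
      (meet≡ˡ t t′ (trans (f-meet t t′) (prefix⇒meet≡ˡ _≟ℕ_ (f t) (f t′) ft⊑ft′)))
      (meet-prefixʳ _≟F_ t t′)

  meet-preserving-IsEmbedding : ∀ {d B} → (∀ t → InTree d t → InCheck B (f t)) → IsEmbedding ℓ d B f
  meet-preserving-IsEmbedding into = record
    { into = into
    ; injective = λ t t′ _ _ → meet-preserving-injective t t′
    ; pres-≺ = λ t t′ _ _ → f-≺ t t′ , meet-preserving-≺⁻ t t′
    ; pres-∧ = λ t t′ _ _ → f-meet t t′
    }

module Unfold {ℓ : ℕ} (grow : List ℕ → List ℕ) where

  fork : List ℕ → List ℕ
  fork c = c ++ grow c

  unfold : List ℕ → List (Fin ℓ) → List ℕ
  unfold c [] = fork c
  unfold c (i ∷ t) = unfold (fork c ++ [ toℕ i ]) t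

  unfold-extends : ∀ c t → IsPrefix c (unfold c t)
  unfold-extends c [] = prefix-++ c (grow c)
  unfold-extends c (i ∷ t) =
    prefix-trans (prefix-trans (prefix-++ c (grow c)) (prefix-++ (fork c) _)) (unfold-extends (fork c ++ [ toℕ i ]) t)

  fork-prefix-unfold : ∀ c t → IsPrefix (fork c) (unfold c t)
  fork-prefix-unfold c [] = prefix-refl (fork c)
  fork-prefix-unfold c (i ∷ t) = prefix-trans (prefix-++ (fork c) _) (unfold-extends (fork c ++ [ toℕ i ]) t)

  unfold-child : ∀ c i t → ∃[ w ] unfold c (i ∷ t) ≡ fork c ++ toℕ i ∷ w
  unfold-child c i t = let (w , eq) = unfold-extends (fork c ++ [ toℕ i ]) t
                       in w , trans (sym eq) (++-assoc (fork c) [ toℕ i ] w)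

  unfold-meet : ∀ c t t′ → unfold c (meet _≟F_ t t′) ≡ meet _≟ℕ_ (unfold c t) (unfold c t′)
  unfold-meet c [] t′ = sym (prefix⇒meet≡ˡ _≟ℕ_ (fork c) (unfold c t′) (fork-prefix-unfold c t′))
  unfold-meet c (i ∷ t) [] = sym (prefix⇒meet≡ʳ _≟ℕ_ (unfold c (i ∷ t)) (fork c) (fork-prefix-unfold c (i ∷ t)))
  unfold-meet c (i ∷ t) (j ∷ t′) with i ≟F j
  ... | yes refl = unfold-meet (fork c ++ [ toℕ i ]) t t′
  ... | no i≢j with unfold-child c i t | unfold-child c j t′
  ...   | w , eq | w′ , eq′ rewrite eq | eq′ =
    sym (meet-fork _≟ℕ_ (fork c) w w′ (i≢j ∘ FinP.toℕ-injective))

  unfold-≺ : ∀ c t t′ → t ≺ t′ → unfold c t ≺ unfold c t′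
  unfold-≺ c [] [] (_ , ())
  unfold-≺ c [] (j ∷ t′) _ = fork-prefix-unfold c (j ∷ t′) ,
    ℕP.<-≤-trans (length-<-snoc (fork c) (toℕ j)) (prefix-length (unfold-extends (fork c ++ [ toℕ j ]) t′))
  unfold-≺ c (i ∷ t) [] ((_ , ()) , _)
  unfold-≺ c (i ∷ t) (j ∷ t′) (i∷t⊑j∷t′ , s≤s t<t′) with prefix-∷⁻ i∷t⊑j∷t′
  ... | refl , t⊑t′ = unfold-≺ (fork c ++ [ toℕ i ]) t t′ (t⊑t′ , t<t′)

  unfold-IsEmbedding : ∀ {d B} c → (∀ t → InTree d t → InCheck B (unfold c t)) → IsEmbedding ℓ d B (unfold c)
  unfold-IsEmbedding c = meet-preserving-IsEmbedding (unfold c) (unfold-meet c) (unfold-≺ c)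

-- The tree dimension of a sorted leaf set is its norm

injective⇒∃-≥-pred : ∀ {ℓ} → 1 ≤ ℓ → (κ : Fin ℓ → ℕ) → (∀ i j → κ i ≡ κ j → i ≡ j) → ∃[ i ] ℓ ∸ 1 ≤ κ i
injective⇒∃-≥-pred {suc ℓ} _ κ κ-injective with FinP.any? (λ i → ℓ ≤? κ i)
... | yes found = found
... | no none with FinP.pigeonhole (ℕP.n<1+n ℓ) (λ i → fromℕ< (ℕP.≰⇒> (none ∘ (i ,_))))
...   | i , j , i<j , eq = ⊥-elim (FinP.<-irrefl (κ-injective i j (FinP.fromℕ<-injective _ _ _ _ eq)) i<j)

module SortedLeafSet (ℓ m n : ℕ) (X : List (List ℕ)) (leaves : IsLeafSet m n X)
  (sorted : ∀ r → Normalization.IsNode ℓ m n r → Normalization.ChildrenSorted ℓ m n X r) where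
  open Norms ℓ
  open Normalization ℓ m n using (IsNode)

  leaf-prefix-IsNode : ∀ {b r x} → b ∈ X → IsPrefix (r ++ [ x ]) b → IsNode r × x < m
  leaf-prefix-IsNode {b} {r} {x} b∈X r++x⊑b =
    (r<n , λ z z∈r → entries z (prefix-∈ r++x⊑b (∈-++⁺ˡ z∈r))) , entries x (prefix-∈ r++x⊑b (∈-++⁺ʳ r (here refl)))
    where
    entries : Entries< m b
    entries = proj₂ (leaves b b∈X)
    r<n : length r < n
    r<n = subst (length r <_) (proj₁ (leaves b b∈X)) (ℕP.<-≤-trans (length-<-snoc r x) (prefix-length r++x⊑b))

  score-≥-leftward : ∀ {r e i j} → IsNode r → i ≤ j → j < m →
    + e ℤ.≤ score ℓ X (r ++ [ j ]) → + e ℤ.≤ score ℓ X (r ++ [ i ])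
  score-≥-leftward {r} {e} {i} {j} r-node i≤j j<m e≤ =
    ℤP.≤-trans e≤ (sorted r r-node j z≤n j<m (ℤP.≤-trans (ℤ.+≤+ z≤n) e≤) i i≤j)

  module _ (ℓ≥1 : 1 ≤ ℓ) {d f} (E : IsEmbedding ℓ d X f) where
    open IsEmbedding E

    big-direction : ∀ t → suc (length t) ≤ d → ∃₂ λ i x → ℓ ∸ 1 ≤ x × IsPrefix (f t ++ [ x ]) (f (t ++ [ i ]))
    big-direction t t<d = let (i , big) = injective⇒∃-≥-pred ℓ≥1 κ κ-injective in i , κ i , big , κ-prefix i
      where
      t∈ : InTree d t
      t∈ = ℕP.<⇒≤ t<d
      child∈ : ∀ i → InTree d (t ++ [ i ])
      child∈ i = subst (_≤ d) (sym (length-snoc t i)) t<d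
      direction : ∀ i → ∃[ x ] IsPrefix (f t ++ [ x ]) (f (t ++ [ i ]))
      direction i = ≺⇒prefix-snoc _ _ (proj₁ (pres-≺ t (t ++ [ i ]) t∈ (child∈ i)) (≺-snoc t i))
      κ : Fin ℓ → ℕ
      κ i = proj₁ (direction i)
      κ-prefix : ∀ i → IsPrefix (f t ++ [ κ i ]) (f (t ++ [ i ]))
      κ-prefix i = proj₂ (direction i)
      κ-injective : ∀ i j → κ i ≡ κ j → i ≡ j
      κ-injective i j κi≡κj with i ≟F j
      ... | yes i≡j = i≡j
      ... | no i≢j = ⊥-elim (ℕP.<-irrefl refl (ℕP.<-≤-trans (length-<-snoc (f t) (κ i))
          (subst (λ s → length (f t ++ [ κ i ]) ≤ length s) meet≡ft (prefix-length below-meet))))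
        where
        meet≡ft : meet _≟ℕ_ (f (t ++ [ i ])) (f (t ++ [ j ])) ≡ f t
        meet≡ft = trans (sym (pres-∧ (t ++ [ i ]) (t ++ [ j ]) (child∈ i) (child∈ j)))
                        (cong f (meet-fork _≟F_ t [] [] i≢j))
        below-meet : IsPrefix (f t ++ [ κ i ]) (meet _≟ℕ_ (f (t ++ [ i ])) (f (t ++ [ j ])))
        below-meet = meet-greatest _≟ℕ_ _ _ _ (κ-prefix i)
          (subst (λ x → IsPrefix (f t ++ [ x ]) (f (t ++ [ j ]))) (sym κi≡κj) (κ-prefix j))

    score-≥-height : ∀ e t → length t + e ≡ d → + e ℤ.≤ score ℓ X (f t)
    score-≥-height zero t eq with into t (subst (_≤ d) (ℕP.+-identityʳ (length t)) (ℕP.≤-reflexive eq))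
    ... | b , b∈X , (v , refl) = ℤP.≤-trans (ℤ.+≤+ z≤n) (score-≥-suffix X (f t) v b∈X)
    score-≥-height (suc e) t eq =
      climb (big-direction t (ℕP.≤-trans (ℕP.m≤m+n (suc (length t)) e) (ℕP.≤-reflexive height)))
      where
      height : suc (length t) + e ≡ d
      height = trans (sym (ℕP.+-suc (length t) e)) eq
      climb : ∃₂ (λ i x → ℓ ∸ 1 ≤ x × IsPrefix (f t ++ [ x ]) (f (t ++ [ i ]))) → + suc e ℤ.≤ score ℓ X (f t)
      climb (i , x , big , ft++x⊑child) = ℤP.≤-trans (ℤP.+-monoʳ-≤ (+ 1) e≤) (score-suc-big-child X (f t) ℕP.≤-refl)
        where
        child-height : length (t ++ [ i ]) + e ≡ d
        child-height = trans (cong (_+ e) (length-snoc t i)) height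
        leaf : InCheck X (f (t ++ [ i ]))
        leaf = into (t ++ [ i ]) (ℕP.m+n≤o⇒m≤o _ (ℕP.≤-reflexive child-height))
        ft-node : IsNode (f t) × x < m
        ft-node = leaf-prefix-IsNode (proj₁ (proj₂ leaf)) (prefix-trans ft++x⊑child (proj₂ (proj₂ leaf)))
        e≤ : + e ℤ.≤ score ℓ X (f t ++ [ ℓ ∸ 1 ])
        e≤ = score-≥-leftward (proj₁ ft-node) big (proj₂ ft-node)
               (ℤP.≤-trans (score-≥-height e (t ++ [ i ]) child-height) (score-antitone X ft++x⊑child))

    TreeEmbeds⇒≤setNorm : + d ℤ.≤ setNorm ℓ X
    TreeEmbeds⇒≤setNorm = ℤP.≤-trans (score-≥-height d [] refl)
      (ℤP.≤-trans (score-antitone X {[]} (f [] , refl)) (ℤP.≤-reflexive (score-root X)))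

  smallPrefix : List ℕ → List ℕ
  smallPrefix [] = []
  smallPrefix (x ∷ v) with x <? ℓ ∸ 1
  ... | yes _ = x ∷ smallPrefix v
  ... | no _ = []

  smallPrefix-prefix : ∀ v → IsPrefix (smallPrefix v) v
  smallPrefix-prefix [] = [] , refl
  smallPrefix-prefix (x ∷ v) with x <? ℓ ∸ 1
  ... | yes _ = prefix-∷ x (smallPrefix-prefix v)
  ... | no _ = x ∷ v , refl

  nodeNorm-smallPrefix : ∀ v → nodeNorm ℓ (smallPrefix v) ≡ 0
  nodeNorm-smallPrefix [] = refl
  nodeNorm-smallPrefix (x ∷ v) with x <? ℓ ∸ 1
  ... | yes small = trans (nodeNorm-∷-small (smallPrefix v) (ℕP.<⇒≱ small)) (nodeNorm-smallPrefix v)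
  ... | no _ = refl

  smallPrefix-split : ∀ v → 0 < nodeNorm ℓ v → ∃₂ λ x v′ → v ≡ smallPrefix v ++ x ∷ v′ × ℓ ∸ 1 ≤ x
  smallPrefix-split (x ∷ v) pos with x <? ℓ ∸ 1
  ... | yes small = let (y , v′ , eq , big) = smallPrefix-split v (subst (0 <_) (nodeNorm-∷-small v (ℕP.<⇒≱ small)) pos)
                    in y , v′ , cong (x ∷_) eq , big
  ... | no notSmall = x , v , refl , ℕP.≮⇒≥ notSmall

  -- The embedding follows the heaviest leaf below c to just before its first entry x ≥ ℓ − 1
  -- and branches there; by sortedness the children 0, …, ℓ − 1 ≤ x score at least as well as x.
  open Unfold {ℓ} (smallPrefix ∘ heaviestSuffix X)

  fork-big-child : ∀ k c → + suc k ℤ.≤ score ℓ X c →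
    ∃[ x ] ℓ ∸ 1 ≤ x × x < m × IsNode (fork c) × + k ℤ.≤ score ℓ X (fork c ++ [ x ])
  fork-big-child k c 1+k≤ = split (smallPrefix-split v (ℕP.<-≤-trans (s≤s z≤n) 1+k≤‖v‖))
    where
    v : List ℕ
    v = heaviestSuffix X c
    spec : c ++ v ∈ X × score ℓ X c ≡ + nodeNorm ℓ v
    spec = heaviestSuffix-spec X c (score-nonneg⇒restrict≢[] X c (ℤP.≤-trans (ℤ.+≤+ z≤n) 1+k≤))
    1+k≤‖v‖ : suc k ≤ nodeNorm ℓ v
    1+k≤‖v‖ = ℤP.drop‿+≤+ (subst (+ suc k ℤ.≤_) (proj₂ spec) 1+k≤)
    split : (∃₂ λ x v′ → v ≡ smallPrefix v ++ x ∷ v′ × ℓ ∸ 1 ≤ x) →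
      ∃[ x ] ℓ ∸ 1 ≤ x × x < m × IsNode (fork c) × + k ℤ.≤ score ℓ X (fork c ++ [ x ])
    split (x , v′ , v≡ , big) =
      x , big , proj₂ fork-node , proj₁ fork-node , ℤP.≤-trans (ℤ.+≤+ k≤‖v′‖) (score-≥-suffix X (fork c ++ [ x ]) v′ leaf)
      where
      leaf : (fork c ++ [ x ]) ++ v′ ∈ X
      leaf = subst (_∈ X) (begin
        c ++ v                            ≡⟨ cong (c ++_) v≡ ⟩
        c ++ (smallPrefix v ++ x ∷ v′)    ≡⟨ ++-assoc c (smallPrefix v) (x ∷ v′) ⟨
        fork c ++ x ∷ v′                  ≡⟨ ++-assoc (fork c) [ x ] v′ ⟨
        (fork c ++ [ x ]) ++ v′           ∎) (proj₁ spec)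
        where open ≡-Reasoning
      fork-node : IsNode (fork c) × x < m
      fork-node = leaf-prefix-IsNode leaf (prefix-++ (fork c ++ [ x ]) v′)
      ‖v‖≡ : nodeNorm ℓ v ≡ suc (nodeNorm ℓ v′)
      ‖v‖≡ = begin
        nodeNorm ℓ v                                       ≡⟨ cong (nodeNorm ℓ) v≡ ⟩
        nodeNorm ℓ (smallPrefix v ++ x ∷ v′)               ≡⟨ nodeNorm-++ (smallPrefix v) (x ∷ v′) ⟩
        nodeNorm ℓ (smallPrefix v) + nodeNorm ℓ (x ∷ v′)   ≡⟨ cong₂ _+_ (nodeNorm-smallPrefix v) (nodeNorm-∷-big v′ big) ⟩
        suc (nodeNorm ℓ v′)                                ∎
        where open ≡-Reasoning
      k≤‖v′‖ : k ≤ nodeNorm ℓ v′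
      k≤‖v′‖ = ℕ.s≤s⁻¹ (subst (suc k ≤_) ‖v‖≡ 1+k≤‖v‖)

  unfold-in-check : ∀ t k c → length t ≤ k → + k ℤ.≤ score ℓ X c → InCheck X (unfold c t)
  unfold-in-check [] k c _ k≤ =
    _ , proj₁ (heaviestSuffix-spec X c (score-nonneg⇒restrict≢[] X c (ℤP.≤-trans (ℤ.+≤+ z≤n) k≤))) ,
    prefix-++-cong c (smallPrefix-prefix (heaviestSuffix X c))
  unfold-in-check (i ∷ t) (suc k) c (s≤s t≤k) 1+k≤ = descend (fork-big-child k c 1+k≤)
    where
    i≤ℓ-1 : toℕ i ≤ ℓ ∸ 1
    i≤ℓ-1 = subst (toℕ i ≤_) (sym (∸1≡pred ℓ)) (ℕP.<⇒≤pred (FinP.toℕ<n i))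
    descend : ∃[ x ] ℓ ∸ 1 ≤ x × x < m × IsNode (fork c) × + k ℤ.≤ score ℓ X (fork c ++ [ x ]) →
      InCheck X (unfold c (i ∷ t))
    descend (x , big , x<m , fork-node , k≤) =
      unfold-in-check t k (fork c ++ [ toℕ i ]) t≤k (score-≥-leftward fork-node (ℕP.≤-trans i≤ℓ-1 big) x<m k≤)

  setNorm≡⇒TreeEmbeds : ∀ D → setNorm ℓ X ≡ + D → TreeEmbeds ℓ D X
  setNorm≡⇒TreeEmbeds D setNorm≡ = unfold [] , unfold-IsEmbedding []
    (λ t t≤D → unfold-in-check t D [] t≤D (ℤP.≤-reflexive (sym (trans (score-root X) setNorm≡))))

  sorted-MTD : 1 ≤ ℓ → X ≢ [] →
    ∃[ D ] (setNorm ℓ X ≡ + D × TreeEmbeds ℓ D X × (∀ d → TreeEmbeds ℓ d X → d ≤ D))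
  sorted-MTD ℓ≥1 X≢[] = D , setNorm≡ , setNorm≡⇒TreeEmbeds D setNorm≡ ,
    λ d (_ , E) → ℤP.drop‿+≤+ (subst (+ d ℤ.≤_) setNorm≡ (TreeEmbeds⇒≤setNorm ℓ≥1 E))
    where
    D : ℕ
    D = nodeNorm ℓ (argmax X)
    setNorm≡ : setNorm ℓ X ≡ + D
    setNorm≡ = proj₂ (argmax-spec X X≢[])


module _ (ℓ m n : ℕ) (enum : List (List ℕ)) where
  open Normalization ℓ m n

  normalize-[] : normalize m ℓ enum [] ≡ []
  normalize-[] = normalize-preserves (_≡ []) (λ _ a k _ X≡[] → cong (map (swap a k)) X≡[]) enum [] refl

  normalize-≢[] : ∀ {B} → B ≢ [] → normalize m ℓ enum B ≢ []
  normalize-≢[] = normalize-preserves (_≢ []) (λ { [] _ _ _ []≢[] _ → []≢[] refl ; (_ ∷ _) _ _ _ _ () }) enum _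

  IsLeafSet-normalize : ∀ {B} → IsLeafSet m n B → IsLeafSet m n (normalize m ℓ enum B)
  IsLeafSet-normalize = normalize-preserves (IsLeafSet m n) (λ _ a k → IsLeafSet-swap a k) enum _

  TreeEmbeds-normalize⇔ : ∀ d B → TreeEmbeds ℓ d B ⇔ TreeEmbeds ℓ d (normalize m ℓ enum B)
  TreeEmbeds-normalize⇔ d B = normalize-preserves (λ X → TreeEmbeds ℓ d B ⇔ TreeEmbeds ℓ d X)
    (λ X a k _ B⇔X → TreeEmbeds-swap⇔ X a k ⇔-∘ B⇔X) enum B (⇔-id (TreeEmbeds ℓ d B))

theorem2p8 : (m ℓ n : ℕ) → 2 ≤ ℓ → ℓ ≤ m →
    (B : List (List ℕ)) → IsLeafSet m n B →
    (enum : List (List ℕ)) → enum ↭ nodesLt m n →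
    AllPairs (λ x y → length x ≥ length y) enum →
    IsMTD ℓ B (setNorm ℓ (normalize m ℓ enum B))
-- ℓ ≤ m is not needed: for ℓ > m no entry reaches ℓ − 1 and no node has ℓ children.
theorem2p8 m ℓ n ℓ≥2 _ B leaves enum enum↭ descending with B ≟ᴸ []
... | yes refl = inj₁ (refl , cong (setNorm ℓ) (normalize-[] ℓ m n enum))
... | no B≢[] =
  let (D , setNorm≡ , embeds , maximal) = sorted-MTD (ℕP.<⇒≤ ℓ≥2) (normalize-≢[] ℓ m n enum B≢[])
  in inj₂ (B≢[] , D , setNorm≡ , Equivalence.from (embeds⇔ D) embeds , λ d → maximal d ∘ Equivalence.to (embeds⇔ d))
  where
  open SortedLeafSet ℓ m n (normalize m ℓ enum B) (IsLeafSet-normalize ℓ m n enum leaves)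
    (Normalization.normalize-sorted ℓ m n enum B enum↭ descending)
  embeds⇔ : ∀ d → TreeEmbeds ℓ d B ⇔ TreeEmbeds ℓ d (normalize m ℓ enum B)
  embeds⇔ d = TreeEmbeds-normalize⇔ ℓ m n enum d B
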